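{- Exact identification of Boolean functions of $n$ variables that are read-once over the basis of all monotone threshold functions, using membership and subcube identity queries, requires at least $\binom{n}{\lfloor n/2\rfloor}$ queries in the worst case.
   Context: A threshold function is a Boolean function $f(x_1,\ldots,x_m)$ with $f(x)=1\iff \alpha_1x_1+\cdots+\alpha_mx_m\ge\alpha_0$ for some reals $\alpha_i$; it is monotone threshold if this holds with $\alpha_1,\ldots,\alpha_m\ge0$. A formula over a basis $\mathcal B$ is read-once if every variable occurs in it exactly once; a Boolean function of $X=\{x_1,\ldots,x_n\}$ is read-once over $\mathcal B$ if it is expressible by such a formula (other variables are fictitious). A partial assignment $p$ is a map $X\to\{0,1,*\}$; the projection $f_p$ is the function of $p^{ -1}(*)$ obtained by fixing the others to their values under $p$. A membership query takes a total assignment $a$ and returns $f(a)$; a subcube identity query takes a partial assignment $p$ and returns "yes" iff $f_p\equiv0$ or $f_p\equiv1$. Exact identification: a deterministic algorithm, knowing the basis and $X$, adaptively queries the unknown target from the class and must determine it; the bound concerns the worst-case number of queries. -}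

module Defs where

open import Data.Nat using (ℕ; zero; suc; _+_; _*_; _≤_)
open import Data.Nat.Combinatorics using (_C_)
open import Data.Nat.DivMod using (_/_)
open import Data.Integer as ℤ using (ℤ; +_)
open import Data.Bool using (Bool; true; false)
open import Data.Fin using (Fin)
open import Data.Vec using (Vec; []; _∷_)
open import Data.List using (List; []; _++_)
import Data.List as List
open import Data.List.Relation.Unary.Unique.Propositional using (Unique)
open import Data.Maybe using (Maybe; just; nothing)
open import Data.Product using (Σ; ∃; _×_; _,_)
open import Data.Sum using (_⊎_)
open import Relation.Binary.PropositionalEquality using (_≡_)
open import Relation.Nullary using (¬_)

Assignment : ℕ → Set
Assignment n = Fin n → Bool

BoolFun : ℕ → Set
BoolFun n = Assignment n → Bool

bit : Bool → ℕ
bit true  = 1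
bit false = 0

-- A gate of arity m carries weights α_1..α_m ≥ 0 (natural numbers) and a
-- threshold α_0 (an integer); it outputs 1 iff α_1 y_1 + ... + α_m y_m ≥ α_0.
data Formula (n : ℕ) : Set where
  var  : Fin n → Formula n
  gate : (m : ℕ) → Vec ℕ m → ℤ → Vec (Formula n) m → Formula n

thrVal : ∀ {m} → Vec ℕ m → ℤ → Vec Bool m → Bool
thrVal ws t ys = t ℤ.≤ᵇ (+ wsum ws ys)
  where
  wsum : ∀ {k} → Vec ℕ k → Vec Bool k → ℕ
  wsum [] [] = 0
  wsum (w ∷ ws) (y ∷ ys) = w * bit y + wsum ws ys

mutual
  eval : ∀ {n} → Formula n → Assignment n → Bool
  eval (var i) a = a i
  eval (gate m ws t φs) a = thrVal ws t (evalAll φs a)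

  evalAll : ∀ {n m} → Vec (Formula n) m → Assignment n → Vec Bool m
  evalAll [] a = []
  evalAll (φ ∷ φs) a = eval φ a ∷ evalAll φs a

mutual
  vars : ∀ {n} → Formula n → List (Fin n)
  vars (var i) = i List.∷ []
  vars (gate m ws t φs) = varsAll φs

  varsAll : ∀ {n m} → Vec (Formula n) m → List (Fin n)
  varsAll [] = []
  varsAll (φ ∷ φs) = vars φ ++ varsAll φs

ReadOnceFormula : ∀ {n} → Formula n → Set
ReadOnceFormula φ = Unique (vars φ)

ReadOnceMT : ∀ {n} → BoolFun n → Set
ReadOnceMT {n} f = Σ (Formula n) λ φ → ReadOnceFormula φ × (∀ a → eval φ a ≡ f a)

-- Partial assignments: nothing = *.
PartialAssignment : ℕ → Set
PartialAssignment n = Fin n → Maybe Bool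

Extends : ∀ {n} → Assignment n → PartialAssignment n → Set
Extends a p = ∀ i b → p i ≡ just b → a i ≡ b

SubcubeConst : ∀ {n} → BoolFun n → PartialAssignment n → Set
SubcubeConst f p = (∀ a → Extends a p → f a ≡ false) ⊎ (∀ a → Extends a p → f a ≡ true)

data Alg (n : ℕ) : Set where
  done : BoolFun n → Alg n
  memQ : Assignment n → (Bool → Alg n) → Alg n
  subQ : PartialAssignment n → (Bool → Alg n) → Alg n

data Run {n : ℕ} (f : BoolFun n) : Alg n → BoolFun n → ℕ → Set where
  run-done : ∀ g → Run f (done g) g 0
  run-mem  : ∀ a k {g c} → Run f (k (f a)) g c → Run f (memQ a k) g (suc c)
  run-yes  : ∀ p k {g c} → SubcubeConst f p → Run f (k true) g c → Run f (subQ p k) g (suc c)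
  run-no   : ∀ p k {g c} → ¬ SubcubeConst f p → Run f (k false) g c → Run f (subQ p k) g (suc c)

ExactlyIdentifies : ∀ {n} → Alg n → Set
ExactlyIdentifies {n} A =
  ∀ (f : BoolFun n) → ReadOnceMT f →
    Σ (BoolFun n) λ g → Σ ℕ λ c → Run f A g c × (∀ a → g a ≡ f a)

-- The adversary answers every query as the target atLeast, x ↦ [weight x ≥ k]
-- with k = ⌊n/2⌋. For each point b of weight k, the function that agrees with
-- atLeast except that it vanishes at b is again a single monotone threshold gate.
-- Charge every query to one point: a membership query to the queried point, a
-- subcube query to its lower corner if atLeast is 1 there and to its upper corner
-- otherwise. Puncturing atLeast at an uncharged b changes no answer, so the run is
-- also a run on the punctured target and outputs the same function, which is wrong
-- at b for one of the two targets. Hence the charged points, one per query,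
-- include all C(n,k) points of weight k.

module Submission where

open import Defs
open import Data.Bool using (Bool; true; false; not; _∧_; if_then_else_)
open import Data.Bool.Properties using (∧-inverseʳ; ∧-identityʳ; T-≡) renaming (_≟_ to _≟ᵇ_)
open import Data.Fin using (Fin; zero; suc)
open import Data.Fin.Properties using (all?)
open import Data.Integer using (+_)
open import Data.List using (List; []; _∷_; length)
import Data.List as List
open import Data.List.Relation.Unary.Any using (Any; here; there; any?)
open import Data.List.Relation.Unary.Unique.Propositional using (Unique)
open import Data.List.Relation.Unary.Unique.Propositional.Properties using (tabulate⁺)
open import Data.Maybe using (just; nothing; fromMaybe)
open import Data.Nat using (ℕ; zero; suc; _+_; _*_; _∸_; _≤_; _<_; _≤ᵇ_; _≤?_; s≤s; z≤n)
open import Data.Nat.Combinatorics using (_C_; nCk+nC[k+1]≡[n+1]C[k+1])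
open import Data.Nat.DivMod using (_/_)
open import Data.Nat.Properties
open import Algebra.Properties.Semiring.Sum +-*-semiring
  using (sum; ∑-distrib-+; *-distribˡ-sum; sum-cong-≗; sum-replicate-zero)
open import Data.Product using (Σ; _×_; _,_; proj₁; proj₂)
open import Data.Sum using (inj₁; inj₂)
open import Data.Vec using (Vec; _∷_; tabulate)
open import Data.Vec.Functional as Vector using (tail)
open import Function using (_∘_; _⇔_; mk⇔; Equivalence)
import Function.Properties.Equivalence as ⇔
open import Relation.Binary.PropositionalEquality
open import Relation.Nullary using (¬_; does; yes; no; contradiction)
open import Relation.Nullary.Decidable using (dec-true; dec-false; does-⇔)

≤ᵇ-shift : ∀ m c s → (m ≤ᵇ c + s) ≡ (m ∸ c ≤ᵇ s)
≤ᵇ-shift m c s = does-⇔ (mk⇔ (m≤n+o⇒m∸n≤o m c) m∸c≤s⇒m≤c+s) (m ≤? c + s) (m ∸ c ≤? s)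
  where
  m∸c≤s⇒m≤c+s : m ∸ c ≤ s → m ≤ c + s
  m∸c≤s⇒m≤c+s h = ≤-trans (m≤n+m∸n m c) (+-monoʳ-≤ c h)

≤⇒≤ᵇ≡true : ∀ {m n} → m ≤ n → (m ≤ᵇ n) ≡ true
≤⇒≤ᵇ≡true {m} {n} = dec-true (m ≤? n)

>⇒≤ᵇ≡false : ∀ {m n} → n < m → (m ≤ᵇ n) ≡ false
>⇒≤ᵇ≡false {m} {n} n<m = dec-false (m ≤? n) (<⇒≱ n<m)

≤ᵇ≡true⇒≤ : ∀ {m n} → (m ≤ᵇ n) ≡ true → m ≤ n
≤ᵇ≡true⇒≤ {m} {n} eq = ≤ᵇ⇒≤ m n (Equivalence.from T-≡ eq)

-- The weighted sum inside thrVal is local to Defs and is never named here: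
-- consuming an input lowers the threshold, and unification supplies the sum of
-- the remaining inputs.
thrVal-∷ : ∀ {m} w (ws : Vec ℕ m) t y ys →
  thrVal (w ∷ ws) (+ t) (y ∷ ys) ≡ thrVal ws (+ (t ∸ w * bit y)) ys
thrVal-∷ w ws t y ys = ≤ᵇ-shift t (w * bit y) _

thrVal-tabulate : ∀ {m} (w : Fin m → ℕ) t (y : Fin m → Bool) →
  thrVal (tabulate w) (+ t) (tabulate y) ≡ (t ≤ᵇ sum (λ i → w i * bit (y i)))
thrVal-tabulate {zero} w t y = refl
thrVal-tabulate {suc m} w t y = begin
  thrVal (tabulate w) (+ t) (tabulate y)
    ≡⟨ thrVal-∷ (w zero) (tabulate (w ∘ suc)) t (y zero) (tabulate (y ∘ suc)) ⟩
  thrVal (tabulate (w ∘ suc)) (+ (t ∸ c)) (tabulate (y ∘ suc))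
    ≡⟨ thrVal-tabulate (w ∘ suc) (t ∸ c) (y ∘ suc) ⟩
  (t ∸ c ≤ᵇ sum (λ i → w (suc i) * bit (y (suc i))))
    ≡⟨ ≤ᵇ-shift t c _ ⟨
  (t ≤ᵇ sum (λ i → w i * bit (y i)))
    ∎
  where
  open ≡-Reasoning
  c : ℕ
  c = w zero * bit (y zero)

evalAll-tabulate-var : ∀ {m n} (g : Fin m → Fin n) a →
  evalAll (tabulate (var ∘ g)) a ≡ tabulate (a ∘ g)
evalAll-tabulate-var {zero} g a = refl
evalAll-tabulate-var {suc m} g a = cong (a (g zero) ∷_) (evalAll-tabulate-var (g ∘ suc) a)

varsAll-tabulate-var : ∀ {m n} (g : Fin m → Fin n) →
  varsAll (tabulate (var ∘ g)) ≡ List.tabulate g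
varsAll-tabulate-var {zero} g = refl
varsAll-tabulate-var {suc m} g = cong (g zero ∷_) (varsAll-tabulate-var (g ∘ suc))

thresholdGate : ∀ {n} → (Fin n → ℕ) → ℕ → Formula n
thresholdGate {n} w t = gate n (tabulate w) (+ t) (tabulate var)

thresholdGate-readOnce : ∀ {n} (w : Fin n → ℕ) t → ReadOnceFormula (thresholdGate w t)
thresholdGate-readOnce w t =
  subst Unique (sym (varsAll-tabulate-var (λ i → i))) (tabulate⁺ (λ eq → eq))

eval-thresholdGate : ∀ {n} (w : Fin n → ℕ) t a →
  eval (thresholdGate w t) a ≡ (t ≤ᵇ sum (λ i → w i * bit (a i)))
eval-thresholdGate w t a =
  trans (cong (thrVal (tabulate w) (+ t)) (evalAll-tabulate-var (λ i → i) a))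
        (thrVal-tabulate w t a)

threshold-readOnceMT : ∀ {n} (w : Fin n → ℕ) t (f : BoolFun n) →
  (∀ a → f a ≡ (t ≤ᵇ sum (λ i → w i * bit (a i)))) → ReadOnceMT f
threshold-readOnceMT w t f f≡ =
  thresholdGate w t , thresholdGate-readOnce w t ,
  λ a → trans (eval-thresholdGate w t a) (sym (f≡ a))

_⊆_ : ∀ {n} → Assignment n → Assignment n → Set
x ⊆ y = ∀ i → x i ≡ true → y i ≡ true

weight : ∀ {n} → Assignment n → ℕ
weight a = sum (λ i → bit (a i))

outside : ∀ {n} → Assignment n → Assignment n → ℕ
outside x y = weight (λ i → x i ∧ not (y i))

bit-split : ∀ {u v} → (u ≡ true → v ≡ true) → bit v ≡ bit u + bit (v ∧ not u)
bit-split {false} {v} _ = cong bit (sym (∧-identityʳ v))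
bit-split {true} u⇒v rewrite u⇒v refl = refl

bit-∧ : ∀ u v → bit (u ∧ v) ≡ bit u * bit v
bit-∧ false v = refl
bit-∧ true v = sym (+-identityʳ (bit v))

weight-split : ∀ {n} {x y : Assignment n} → x ⊆ y → weight y ≡ weight x + outside y x
weight-split {x = x} {y} x⊆y =
  trans (sum-cong-≗ (λ i → bit-split (x⊆y i))) (∑-distrib-+ (λ i → bit (x i)) _)

weight-mono : ∀ {n} {x y : Assignment n} → x ⊆ y → weight x ≤ weight y
weight-mono x⊆y = ≤-trans (m≤m+n _ _) (≤-reflexive (sym (weight-split x⊆y)))

weight-cong : ∀ {n} {x y : Assignment n} → x ≗ y → weight x ≡ weight y
weight-cong x≗y = sum-cong-≗ (cong bit ∘ x≗y)

weight≡0⇒false : ∀ {n} (a : Assignment n) → weight a ≡ 0 → ∀ i → a i ≡ false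
weight≡0⇒false a eq zero with a zero | m+n≡0⇒m≡0 (bit (a zero)) eq
... | false | _ = refl
weight≡0⇒false a eq (suc i) = weight≡0⇒false (tail a) (m+n≡0⇒n≡0 (bit (a zero)) eq) i

outside≡0⇒⊆ : ∀ {n} {x y : Assignment n} → outside x y ≡ 0 → x ⊆ y
outside≡0⇒⊆ {x = x} {y} eq i = ∧-not≡false⇒ (x i) (y i) (weight≡0⇒false _ eq i)
  where
  ∧-not≡false⇒ : ∀ u v → u ∧ not v ≡ false → u ≡ true → v ≡ true
  ∧-not≡false⇒ true true _ _ = refl

outside-self : ∀ {n} (x : Assignment n) → outside x x ≡ 0
outside-self {n} x = trans (sum-cong-≗ (cong bit ∘ ∧-inverseʳ ∘ x)) (sum-replicate-zero n)

outside-monoˡ : ∀ {n} {x x′ : Assignment n} y → x ⊆ x′ → outside x y ≤ outside x′ y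
outside-monoˡ {x = x} {x′} y x⊆x′ = weight-mono λ i → ∧-monoˡ (x i) (x′ i) (not (y i)) (x⊆x′ i)
  where
  ∧-monoˡ : ∀ u u′ v → (u ≡ true → u′ ≡ true) → u ∧ v ≡ true → u′ ∧ v ≡ true
  ∧-monoˡ true u′ true u⇒u′ _ rewrite u⇒u′ refl = refl

outside≤weight : ∀ {n} (x y : Assignment n) → outside x y ≤ weight x
outside≤weight x y = weight-mono λ i → ∧≡true⇒ˡ (x i) (not (y i))
  where
  ∧≡true⇒ˡ : ∀ u v → u ∧ v ≡ true → u ≡ true
  ∧≡true⇒ˡ true v _ = refl

⊆-weight-antisym : ∀ {n} {x y : Assignment n} → x ⊆ y → weight y ≤ weight x → x ≗ y
⊆-weight-antisym {x = x} {y} x⊆y wy≤wx i = ⇒-antisym (x i) (y i) (x⊆y i) (y⊆x i)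
  where
  no-excess : outside y x ≡ 0
  no-excess = n≤0⇒n≡0 (+-cancelˡ-≤ (weight x) _ 0
    (subst₂ _≤_ (weight-split x⊆y) (sym (+-identityʳ (weight x))) wy≤wx))
  y⊆x : y ⊆ x
  y⊆x = outside≡0⇒⊆ no-excess
  ⇒-antisym : ∀ u v → (u ≡ true → v ≡ true) → (v ≡ true → u ≡ true) → u ≡ v
  ⇒-antisym false false _ _ = refl
  ⇒-antisym false true _ v⇒u = v⇒u refl
  ⇒-antisym true v u⇒v _ = sym (u⇒v refl)

lo hi : ∀ {n} → PartialAssignment n → Assignment n
lo p i = fromMaybe false (p i)
hi p i = fromMaybe true (p i)

lo-extends : ∀ {n} (p : PartialAssignment n) → Extends (lo p) p
lo-extends p i v eq = cong (fromMaybe false) eq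

hi-extends : ∀ {n} (p : PartialAssignment n) → Extends (hi p) p
hi-extends p i v eq = cong (fromMaybe true) eq

extends⇒lo⊆ : ∀ {n} {x : Assignment n} (p : PartialAssignment n) → Extends x p → lo p ⊆ x
extends⇒lo⊆ p x∈p i with p i in eq
... | just v = λ v≡true → trans (x∈p i v eq) v≡true
... | nothing = λ ()

extends⇒⊆hi : ∀ {n} {x : Assignment n} (p : PartialAssignment n) → Extends x p → x ⊆ hi p
extends⇒⊆hi p x∈p i with p i in eq
... | just v = λ xi≡true → trans (sym (x∈p i v eq)) xi≡true
... | nothing = λ _ → refl

Monotone : ∀ {n} → BoolFun n → Set
Monotone f = ∀ {x y} → x ⊆ y → f x ≡ true → f y ≡ true

monotone-false : ∀ {n} {f : BoolFun n} → Monotone f →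
  ∀ {x y} → x ⊆ y → f y ≡ false → f x ≡ false
monotone-false {f = f} mono {x} x⊆y fy≡false with f x in fx
... | false = refl
... | true = trans (sym (mono x⊆y fx)) fy≡false

subcubeConst⇔corners : ∀ {n} {f : BoolFun n} → Monotone f →
  ∀ p → SubcubeConst f p ⇔ (f (lo p) ≡ f (hi p))
subcubeConst⇔corners {f = f} mono p = mk⇔ to from
  where
  to : SubcubeConst f p → f (lo p) ≡ f (hi p)
  to (inj₁ const) = trans (const _ (lo-extends p)) (sym (const _ (hi-extends p)))
  to (inj₂ const) = trans (const _ (lo-extends p)) (sym (const _ (hi-extends p)))
  from : f (lo p) ≡ f (hi p) → SubcubeConst f p
  from corners with f (lo p) in flo
  ... | true  = inj₂ λ x x∈p → mono (extends⇒lo⊆ p x∈p) flo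
  ... | false = inj₁ λ x x∈p → monotone-false mono (extends⇒⊆hi p x∈p) (sym corners)

subcubeConst-cong : ∀ {n} {f f′ : BoolFun n} → Monotone f → Monotone f′ → ∀ p →
  f (lo p) ≡ f′ (lo p) → f (hi p) ≡ f′ (hi p) → SubcubeConst f p ⇔ SubcubeConst f′ p
subcubeConst-cong mono mono′ p lo≡ hi≡ =
  ⇔.trans (subcubeConst⇔corners mono p)
    (⇔.trans (mk⇔ (subst₂ _≡_ lo≡ hi≡) (subst₂ _≡_ (sym lo≡) (sym hi≡)))
      (⇔.sym (subcubeConst⇔corners mono′ p)))

Run-functional : ∀ {n} {f : BoolFun n} {A g g′ c c′} → Run f A g c → Run f A g′ c′ → g ≡ g′
Run-functional (run-done g) (run-done .g) = refl
Run-functional (run-mem a k r) (run-mem .a .k r′) = Run-functional r r′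
Run-functional (run-yes p k _ r) (run-yes .p .k _ r′) = Run-functional r r′
Run-functional (run-yes p k const _) (run-no .p .k ¬const _) = contradiction const ¬const
Run-functional (run-no p k ¬const _) (run-yes .p .k const _) = contradiction const ¬const
Run-functional (run-no p k _ r) (run-no .p .k _ r′) = Run-functional r r′

identified-output : ∀ {n} {A : Alg n} {f g c} → ExactlyIdentifies A → ReadOnceMT f →
  Run f A g c → g ≗ f
identified-output {f = f} identifies readOnce r a with identifies f readOnce
... | g′ , _ , r′ , g′≗f = trans (cong (λ h → h a) (Run-functional r r′)) (g′≗f a)

module Charging {n} (f : BoolFun n) (witness : PartialAssignment n → Assignment n) where

  charged : ∀ {A g c} → Run f A g c → List (Assignment n)
  charged (run-done _) = []
  charged (run-mem a _ r) = a ∷ charged r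
  charged (run-yes p _ _ r) = witness p ∷ charged r
  charged (run-no p _ _ r) = witness p ∷ charged r

  length-charged : ∀ {A g c} (r : Run f A g c) → length (charged r) ≡ c
  length-charged (run-done _) = refl
  length-charged (run-mem _ _ r) = cong suc (length-charged r)
  length-charged (run-yes _ _ _ r) = cong suc (length-charged r)
  length-charged (run-no _ _ _ r) = cong suc (length-charged r)

  module _ (f′ : BoolFun n) (b : Assignment n)
           (agree-mem : ∀ a → ¬ b ≗ a → f a ≡ f′ a)
           (agree-sub : ∀ p → ¬ b ≗ witness p → SubcubeConst f p ⇔ SubcubeConst f′ p) where

    run-transfer : ∀ {A g c} (r : Run f A g c) → ¬ Any (b ≗_) (charged r) → Run f′ A g c
    run-transfer (run-done g) _ = run-done g
    run-transfer {g = g} {suc c} (run-mem a k r) miss =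
      run-mem a k (subst (λ v → Run f′ (k v) g c) (agree-mem a (miss ∘ here))
                         (run-transfer r (miss ∘ there)))
    run-transfer (run-yes p k const r) miss =
      run-yes p k (Equivalence.to (agree-sub p (miss ∘ here)) const) (run-transfer r (miss ∘ there))
    run-transfer (run-no p k ¬const r) miss =
      run-no p k (¬const ∘ Equivalence.from (agree-sub p (miss ∘ here))) (run-transfer r (miss ∘ there))

restrict : ∀ {n} → Bool → List (Assignment (suc n)) → List (Assignment n)
restrict v [] = []
restrict v (x ∷ xs) =
  if does (x zero ≟ᵇ v) then tail x ∷ restrict v xs else restrict v xs

length-restrict : ∀ {n} (L : List (Assignment (suc n))) →
  length (restrict true L) + length (restrict false L) ≡ length L
length-restrict [] = refl
length-restrict (x ∷ xs) with x zero
... | true  = cong suc (length-restrict xs)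
... | false = trans (+-suc _ _) (cong suc (length-restrict xs))

restrict-covers : ∀ {n} v {b : Assignment n} (L : List (Assignment (suc n))) →
  Any ((v Vector.∷ b) ≗_) L → Any (b ≗_) (restrict v L)
restrict-covers v (x ∷ xs) (here eq) with x zero ≟ᵇ v
... | yes _ = here (eq ∘ suc)
... | no x₀≢v = contradiction (sym (eq zero)) x₀≢v
restrict-covers v (x ∷ xs) (there any) with x zero ≟ᵇ v
... | yes _ = there (restrict-covers v xs any)
... | no _  = restrict-covers v xs any

covering-bound : ∀ n k (L : List (Assignment n)) →
  (∀ b → weight b ≡ k → Any (b ≗_) L) → n C k ≤ length L
covering-bound n zero L covers with covers (λ _ → false) (sum-replicate-zero n)
... | here _  = s≤s z≤n
... | there _ = s≤s z≤n
covering-bound zero (suc k) L covers = z≤n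
covering-bound (suc n) (suc k) L covers = begin
  suc n C suc k                                        ≡⟨ nCk+nC[k+1]≡[n+1]C[k+1] n k ⟨
  n C k + n C suc k                                    ≤⟨ +-mono-≤ cover-true cover-false ⟩
  length (restrict true L) + length (restrict false L) ≡⟨ length-restrict L ⟩
  length L                                             ∎
  where
  open ≤-Reasoning
  cover-true : n C k ≤ length (restrict true L)
  cover-true = covering-bound n k (restrict true L)
    λ b wb → restrict-covers true L (covers (true Vector.∷ b) (cong suc wb))
  cover-false : n C suc k ≤ length (restrict false L)
  cover-false = covering-bound n (suc k) (restrict false L)
    λ b wb → restrict-covers false L (covers (false Vector.∷ b) wb)

module Adversary (n k : ℕ) where

  atLeast : BoolFun n
  atLeast a = k ≤ᵇ weight a

  -- For weight b ≡ k this is atLeast switched off at b: the weight k of every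
  -- variable lets k * weight a decide the threshold, and the unit weights of the
  -- variables outside b break the tie at weight k for every a ≢ b.
  atLeastExcept : Assignment n → BoolFun n
  atLeastExcept b a = suc (k * k) ≤ᵇ k * weight a + outside a b

  atLeast-readOnceMT : ReadOnceMT atLeast
  atLeast-readOnceMT = threshold-readOnceMT (λ _ → 1) k atLeast
    λ a → cong (k ≤ᵇ_) (sum-cong-≗ λ i → sym (*-identityˡ (bit (a i))))

  sum-weights-except : (b a : Assignment n) →
    sum {n} (λ i → (k + bit (not (b i))) * bit (a i)) ≡ k * weight a + outside a b
  sum-weights-except b a = begin
    sum (λ i → (k + β i) * α i)           ≡⟨ sum-cong-≗ (λ i → *-distribʳ-+ (α i) k (β i)) ⟩
    sum (λ i → k * α i + β i * α i)       ≡⟨ ∑-distrib-+ (λ i → k * α i) (λ i → β i * α i) ⟩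
    sum (λ i → k * α i) + sum (λ i → β i * α i)
      ≡⟨ cong₂ _+_ (*-distribˡ-sum k α) (sum-cong-≗ λ i → trans (bit-∧ (a i) _) (*-comm (α i) (β i))) ⟨
    k * weight a + outside a b            ∎
    where
    open ≡-Reasoning
    α β : Fin n → ℕ
    α i = bit (a i)
    β i = bit (not (b i))

  atLeastExcept-readOnceMT : ∀ b → ReadOnceMT (atLeastExcept b)
  atLeastExcept-readOnceMT b =
    threshold-readOnceMT (λ i → k + bit (not (b i))) (suc (k * k)) (atLeastExcept b)
      λ a → cong (suc (k * k) ≤ᵇ_) (sym (sum-weights-except b a))

  atLeast-monotone : Monotone atLeast
  atLeast-monotone x⊆y h = ≤⇒≤ᵇ≡true (≤-trans (≤ᵇ≡true⇒≤ {k} h) (weight-mono x⊆y))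

  atLeastExcept-monotone : ∀ b → Monotone (atLeastExcept b)
  atLeastExcept-monotone b x⊆y h = ≤⇒≤ᵇ≡true (≤-trans (≤ᵇ≡true⇒≤ {suc (k * k)} h)
    (+-mono-≤ (*-monoʳ-≤ k (weight-mono x⊆y)) (outside-monoˡ b x⊆y)))

  -- The only point of weight k whose puncture can change the answer to the
  -- subcube query p.
  witness : PartialAssignment n → Assignment n
  witness p = if atLeast (lo p) then lo p else hi p

  open Charging atLeast witness public

  module Puncture (b : Assignment n) (wb≡k : weight b ≡ k) where

    atLeast-at : atLeast b ≡ true
    atLeast-at = ≤⇒≤ᵇ≡true (≤-reflexive (sym wb≡k))

    atLeastExcept-at : atLeastExcept b b ≡ false
    atLeastExcept-at = >⇒≤ᵇ≡false (s≤s (≤-reflexive (begin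
      k * weight b + outside b b ≡⟨ cong₂ (λ w o → k * w + o) wb≡k (outside-self b) ⟩
      k * k + 0                  ≡⟨ +-identityʳ (k * k) ⟩
      k * k                      ∎)))
      where open ≡-Reasoning

    ⊆-heavy⇒≗ : ∀ {x} → x ⊆ b → k ≤ weight x → b ≗ x
    ⊆-heavy⇒≗ {x} x⊆b k≤wx =
      sym ∘ ⊆-weight-antisym x⊆b (subst (_≤ weight x) (sym wb≡k) k≤wx)

    atLeastExcept-elsewhere : ∀ {x} → ¬ b ≗ x → atLeast x ≡ atLeastExcept b x
    atLeastExcept-elsewhere {x} b≢x with k ≤? weight x
    ... | yes k≤wx = trans (≤⇒≤ᵇ≡true k≤wx) (sym (≤⇒≤ᵇ≡true (begin
      suc (k * k)                ≡⟨ +-comm 1 (k * k) ⟩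
      k * k + 1                  ≤⟨ +-mono-≤ (*-monoʳ-≤ k k≤wx) outside-positive ⟩
      k * weight x + outside x b ∎)))
      where
      open ≤-Reasoning
      outside-positive : 1 ≤ outside x b
      outside-positive = n≢0⇒n>0 λ eq → b≢x (⊆-heavy⇒≗ (outside≡0⇒⊆ eq) k≤wx)
    ... | no k≰wx = trans (>⇒≤ᵇ≡false wx<k) (sym (>⇒≤ᵇ≡false (s≤s (begin
      k * weight x + outside x b ≤⟨ +-monoʳ-≤ (k * weight x) outside≤k ⟩
      k * weight x + k           ≡⟨ trans (+-comm _ k) (sym (*-suc k (weight x))) ⟩
      k * suc (weight x)         ≤⟨ *-monoʳ-≤ k wx<k ⟩
      k * k                      ∎))))
      where
      open ≤-Reasoning
      wx<k : weight x < k
      wx<k = ≰⇒> k≰wx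
      outside≤k : outside x b ≤ k
      outside≤k = ≤-trans (outside≤weight x b) (<⇒≤ wx<k)

    corners-agree : ∀ p → ¬ b ≗ witness p →
      atLeast (lo p) ≡ atLeastExcept b (lo p) × atLeast (hi p) ≡ atLeastExcept b (hi p)
    corners-agree p b≢w with atLeast (lo p) in lo-heavy
    ... | true =
      trans (sym lo-heavy) (atLeastExcept-elsewhere b≢w) , atLeastExcept-elsewhere b≢hi
      where
      b≢hi : ¬ b ≗ hi p
      b≢hi b≗hi = b≢w (⊆-heavy⇒≗ (λ i → trans (b≗hi i) ∘ extends⇒lo⊆ p (hi-extends p) i)
                                 (≤ᵇ≡true⇒≤ {k} lo-heavy))
    ... | false =
      trans (sym lo-heavy) (atLeastExcept-elsewhere b≢lo) , atLeastExcept-elsewhere b≢w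
      where
      b≢lo : ¬ b ≗ lo p
      b≢lo b≗lo = contradiction
        (trans (sym atLeast-at) (trans (cong (k ≤ᵇ_) (weight-cong b≗lo)) lo-heavy)) λ ()

    subcube-agree : ∀ p → ¬ b ≗ witness p →
      SubcubeConst atLeast p ⇔ SubcubeConst (atLeastExcept b) p
    subcube-agree p b≢w = subcubeConst-cong atLeast-monotone (atLeastExcept-monotone b) p
      (proj₁ (corners-agree p b≢w)) (proj₂ (corners-agree p b≢w))

    charged-covers : ∀ {A g c} → ExactlyIdentifies A → (r : Run atLeast A g c) →
      Any (b ≗_) (charged r)
    charged-covers {A} {g} {c} identifies r with any? (λ a → all? λ i → b i ≟ᵇ a i) (charged r)
    ... | yes hit = hit
    ... | no miss = contradiction (trans (sym on-atLeast) on-atLeastExcept) λ ()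
      where
      on-atLeast : g b ≡ true
      on-atLeast = trans (identified-output identifies atLeast-readOnceMT r b) atLeast-at
      r′ : Run (atLeastExcept b) A g c
      r′ = run-transfer (atLeastExcept b) b (λ _ → atLeastExcept-elsewhere) subcube-agree r miss
      on-atLeastExcept : g b ≡ false
      on-atLeastExcept =
        trans (identified-output identifies (atLeastExcept-readOnceMT b) r′ b) atLeastExcept-at

corollary2 : (n : ℕ) (A : Alg n) → ExactlyIdentifies A →
    Σ (BoolFun n) λ f → ReadOnceMT f ×
      (∀ g c → Run f A g c → n C (n / 2) ≤ c)
corollary2 n A identifies = atLeast , atLeast-readOnceMT , query-bound
  where
  open Adversary n (n / 2)
  query-bound : ∀ g c → Run atLeast A g c → n C (n / 2) ≤ c
  query-bound g c r = subst (n C (n / 2) ≤_) (length-charged r)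
    (covering-bound n (n / 2) (charged r) λ b wb≡k → Puncture.charged-covers b wb≡k identifies r)
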